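{- Let $d\ge 1$ and $n$ be such that $2^d+d=n/2$. Then there is an exact affine OBDD with $2^{d+1}$ classical states and $2^d+1$ affine states that computes $\mathtt{SSA}_n$.
   Context: Shuffled Storage Access function $\mathtt{SSA}_n:\{0,1\}^n\to\{0,1\}$ ($n$ even, $2^d+d=n/2$): for input $x$, let $I_0=(2i_1<\dots<2i_m)$ be the sorted list of even indices $2i$ with $x_{2i-1}=0$ and $I_1=(2j_1<\dots<2j_k)$ the sorted list of even indices $2i$ with $x_{2i-1}=1$. Let $\mathtt{ShiftX}((a_1,\dots,a_t),b)=(a_2,\dots,a_t,a_1\oplus b)$. Start with $\alpha=0^{2^d}$ and for $r=1,\dots,m$ set $\alpha:=\mathtt{ShiftX}(\alpha,x_{2i_r})$; start with $\beta=0^d$ and for $r=1,\dots,k$ set $\beta:=\mathtt{ShiftX}(\beta,x_{2j_r})$. Then $\mathtt{SSA}_n(x)$ is the bit of $\alpha$ at the address encoded in binary by $\beta$. An affine OBDD (AfOBDD) is a tuple $(S,E,\delta,T,s_I,v_0,S_a,E_a,\pi)$: $S$ is a finite set of classical states with initial state $s_I$ and accepting set $S_a$; $E=\{e_1,\dots,e_{m_2}\}$ is a set of affine states with accepting set $E_a$; $v_0\in\mathbb{R}^{m_2}$ is an initial affine state (a real vector with entries summing to $1$); $\pi$ is a permutation of $\{1,\dots,n\}$; for each step $i$, $\delta_i:S\times\{0,1\}\to S$; and for each step $i$, classical state $s$ and bit $b$, $T_i^{s,b}$ is a real $m_2\times m_2$ matrix each of whose columns sums to $1$. On input $x$ it starts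 in $(s_I,v_0)$; at step $j$, from $(s,v_{j-1})$ it sets $v_j=T_j^{s,x_{\pi(j)}}v_{j-1}$ and then the classical state to $\delta_j(s,x_{\pi(j)})$. If the final classical state is not in $S_a$ it rejects; otherwise it accepts with probability $\sum_{e_i\in E_a}|v_f[i]|/\|v_f\|_1$. It computes $f$ exactly if $1$-inputs are accepted with probability $1$ and $0$-inputs with probability $0$. -}

module Defs where

open import Data.Bool using (Bool; true; false; _xor_; if_then_else_)
open import Data.Nat as ℕ using (ℕ; zero; suc; _^_)
open import Data.Fin using (Fin; zero; suc)
open import Data.List using (List; []; _∷_; _++_; [_]; replicate; foldl; map; filterᵇ)
open import Data.Product using (_×_; _,_; proj₁; proj₂)
open import Data.Rational using (ℚ; 0ℚ; 1ℚ; _+_; _*_; ∣_∣; _÷_; ≢-nonZero)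
open import Data.Rational.Properties using (_≟_)
open import Data.Fin.Permutation using (Permutation′; _⟨$⟩ʳ_)
open import Data.Vec.Functional using (toList)
open import Relation.Nullary using (yes; no)
open import Relation.Binary.PropositionalEquality using (_≡_)

-- The Shuffled Storage Access function.
-- Inputs are x : Fin n → Bool; paper index i (1-based) is Fin index i-1.
-- So the pair (x_{2i-1}, x_{2i}) is (control bit, data bit).

shiftX : List Bool → Bool → List Bool
shiftX []       b = []
shiftX (a ∷ as) b = as ++ [ a xor b ]

pairs : List Bool → List (Bool × Bool)
pairs (a ∷ b ∷ rest) = (a , b) ∷ pairs rest
pairs _              = []

not′ : Bool → Bool
not′ true  = false
not′ false = true

dataBits : Bool → List (Bool × Bool) → List Bool
dataBits true  ps = map proj₂ (filterᵇ proj₁ ps)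
dataBits false ps = map proj₂ (filterᵇ (λ p → not′ (proj₁ p)) ps)

-- address encoded in binary by β = (β₁,…,β_d), β₁ most significant
bin : List Bool → ℕ
bin = foldl (λ acc b → acc ℕ.* 2 ℕ.+ (if b then 1 else 0)) 0

-- bit at 0-based position k (α₁ is at address 0)
bitAt : List Bool → ℕ → Bool
bitAt []       _       = false
bitAt (a ∷ as) zero    = a
bitAt (a ∷ as) (suc k) = bitAt as k

SSA : (d : ℕ) {n : ℕ} → (Fin n → Bool) → Bool
SSA d x = bitAt α (bin β)
  where
  ps = pairs (toList x)
  α  = foldl shiftX (replicate (2 ^ d) false) (dataBits false ps)
  β  = foldl shiftX (replicate d false) (dataBits true ps)

-- Affine OBDDs over the rationals.
-- Classical states S = Fin c, affine states E = Fin m, steps Fin n.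

Σℚ : ∀ {m} → (Fin m → ℚ) → ℚ
Σℚ {zero}  f = 0ℚ
Σℚ {suc m} f = f zero + Σℚ (λ i → f (suc i))

record AfOBDD (n c m : ℕ) : Set where
  field
    δ     : Fin n → Fin c → Bool → Fin c
    T     : Fin n → Fin c → Bool → Fin m → Fin m → ℚ     -- T_j^{s,b} (row, column)
    sI    : Fin c
    v₀    : Fin m → ℚ
    Sa    : Fin c → Bool
    Ea    : Fin m → Bool
    π     : Permutation′ n
    v₀-affine : Σℚ v₀ ≡ 1ℚ
    T-affine  : ∀ j s b col → Σℚ (λ row → T j s b row col) ≡ 1ℚ

module _ {n c m : ℕ} (A : AfOBDD n c m) (x : Fin n → Bool) where
  open AfOBDD A

  step : Fin n → Fin c × (Fin m → ℚ) → Fin c × (Fin m → ℚ)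
  step j (s , v) = δ j s b , (λ r → Σℚ (λ k → T j s b r k * v k))
    where b = x (π ⟨$⟩ʳ j)

  runFrom : ∀ {k} → (Fin k → Fin n) → Fin c × (Fin m → ℚ) → Fin c × (Fin m → ℚ)
  runFrom {zero}  idx st = st
  runFrom {suc k} idx st = runFrom (λ i → idx (suc i)) (step (idx zero) st)

  final : Fin c × (Fin m → ℚ)
  final = runFrom (λ j → j) (sI , v₀)

  safeDiv : ℚ → ℚ → ℚ
  safeDiv p q with q ≟ 0ℚ
  ... | yes _ = 0ℚ
  ... | no q≢0 = _÷_ p q {{≢-nonZero q≢0}}

  accProb : ℚ
  accProb with final
  ... | (s , v) =
    if Sa s
      then safeDiv (Σℚ (λ i → if Ea i then ∣ v i ∣ else 0ℚ)) (Σℚ (λ i → ∣ v i ∣))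
      else 0ℚ

ComputesExactly : ∀ {n c m} → AfOBDD n c m → ((Fin n → Bool) → Bool) → Set
ComputesExactly A f =
  ∀ x → (f x ≡ true → accProb A x ≡ 1ℚ) × (f x ≡ false → accProb A x ≡ 0ℚ)

-- The classical part of the automaton remembers the pending control bit c and the address
-- register β (d bits), hence 2^(d+1) classical states. The storage register α (2^d bits) lives
-- in the affine state as the vector (1 − Σα, α₁, …, α_{2^d}). Each update of α by ShiftX is a
-- map whose new bits are literals (αₖ₊₁, or α₁ / ¬α₁ for the last one) of the old bits; such a
-- map, and also the projection onto a single bit, is realised on encodings by a matrix whose
-- columns sum to 1, the slack coordinate absorbing the difference. At the last step β is known
-- classically, so the matrix projects onto the addressed bit a, leaving (1 − a, a, 0, …, 0);
-- with coordinate 1 as the only accepting affine state the acceptance probability is exactly a.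

module Submission where

open import Defs
open import Data.Nat using (ℕ; _≤_; _+_; _*_; _^_)
open import Data.Product using (Σ)
open import Relation.Binary.PropositionalEquality using (_≡_)

open import Algebra.Bundles using (CommutativeRing)
open import Data.Bool using (Bool; true; false; not; if_then_else_; _xor_)
open import Data.Fin using (Fin; zero; suc; toℕ; combine; remQuot)
open import Data.Fin.Patterns using (0F; 1F)
open import Data.Fin.Permutation using (id)
open import Data.Fin.Properties using (2↔Bool; remQuot-combine)
open import Data.List using (List; []; _∷_; _++_; [_]; foldl; length; replicate)
open import Data.List.Properties using (length-++; length-replicate)
open import Data.Nat using (zero; suc; pred; _≡ᵇ_; _<ᵇ_)
open import Data.Nat.Properties using (+-comm; +-suc; m^n≢0; suc-pred)
open import Data.Product using (_×_; _,_; proj₁; proj₂)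
open import Data.Rational as ℚ using (ℚ; 0ℚ; 1ℚ; ∣_∣)
import Data.Rational.Properties as ℚP
open import Data.Vec.Functional using (toList)
open import Function using (_∘_)
open import Function.Bundles using (Inverse)
open import Relation.Binary.PropositionalEquality
  using (refl; sym; trans; cong; cong₂; subst; module ≡-Reasoning)

open import Algebra.Properties.Semiring.Sum (CommutativeRing.semiring ℚP.+-*-commutativeRing)
  using (sum; sum-cong-≗; sum-replicate-zero; ∑-comm; ∑-distrib-+; *-distribʳ-sum)
open import Algebra.Properties.Group ℚP.+-0-group using (//-rightDividesˡ; x≈z//y)

open ≡-Reasoning

Σℚ≡sum : ∀ {m} (f : Fin m → ℚ) → Σℚ f ≡ sum f
Σℚ≡sum {zero}  f = refl
Σℚ≡sum {suc m} f = cong (f zero ℚ.+_) (Σℚ≡sum (f ∘ suc))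

Σℚ-cong : ∀ {m} {f g : Fin m → ℚ} → (∀ i → f i ≡ g i) → Σℚ f ≡ Σℚ g
Σℚ-cong {f = f} {g} f≗g = trans (Σℚ≡sum f) (trans (sum-cong-≗ f≗g) (sym (Σℚ≡sum g)))

Σℚ-zero : ∀ m → Σℚ {m} (λ _ → 0ℚ) ≡ 0ℚ
Σℚ-zero m = trans (Σℚ≡sum {m} (λ _ → 0ℚ)) (sum-replicate-zero m)

Σℚ-distrib-+ : ∀ {m} (f g : Fin m → ℚ) → Σℚ (λ i → f i ℚ.+ g i) ≡ Σℚ f ℚ.+ Σℚ g
Σℚ-distrib-+ {m} f g = begin
  Σℚ (λ i → f i ℚ.+ g i)        ≡⟨ Σℚ≡sum (λ i → f i ℚ.+ g i) ⟩
  sum {m} (λ i → f i ℚ.+ g i)   ≡⟨ ∑-distrib-+ f g ⟩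
  sum f ℚ.+ sum g               ≡⟨ cong₂ ℚ._+_ (Σℚ≡sum f) (Σℚ≡sum g) ⟨
  Σℚ f ℚ.+ Σℚ g                 ∎

_·_ : ∀ {m} → (Fin m → ℚ) → (Fin m → ℚ) → ℚ
u · v = Σℚ (λ c → u c ℚ.* v c)

_⊛_ : ∀ {m k} → (Fin k → Fin m → ℚ) → (Fin m → ℚ) → Fin k → ℚ
(M ⊛ v) r = M r · v

⊛-preserves-mass : ∀ {m} (M : Fin m → Fin m → ℚ) (v : Fin m → ℚ) →
  (∀ c → Σℚ (λ r → M r c) ≡ 1ℚ) → Σℚ (M ⊛ v) ≡ Σℚ v
⊛-preserves-mass {m} M v columns = begin
  Σℚ (M ⊛ v)                                    ≡⟨ Σℚ≡sum (M ⊛ v) ⟩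
  sum (M ⊛ v)                                   ≡⟨ sum-cong-≗ (λ r → Σℚ≡sum (λ c → M r c ℚ.* v c)) ⟩
  sum {m} (λ r → sum {m} (λ c → M r c ℚ.* v c)) ≡⟨ ∑-comm (λ r c → M r c ℚ.* v c) ⟩
  sum {m} (λ c → sum {m} (λ r → M r c ℚ.* v c)) ≡⟨ sum-cong-≗ column ⟩
  sum v                                         ≡⟨ Σℚ≡sum v ⟨
  Σℚ v                                          ∎
  where
  column : ∀ c → sum {m} (λ r → M r c ℚ.* v c) ≡ v c
  column c = begin
    sum {m} (λ r → M r c ℚ.* v c) ≡⟨ *-distribʳ-sum (v c) (λ r → M r c) ⟨
    sum {m} (λ r → M r c) ℚ.* v c ≡⟨ cong (ℚ._* v c) (trans (sym (Σℚ≡sum (λ r → M r c))) (columns c)) ⟩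
    1ℚ ℚ.* v c                    ≡⟨ ℚP.*-identityˡ (v c) ⟩
    v c                           ∎

𝟙 : Bool → ℚ
𝟙 true  = 1ℚ
𝟙 false = 0ℚ

complement : ∀ p a → p ℚ.+ 𝟙 a ≡ 1ℚ → p ≡ 𝟙 (not a)
complement p true  p+1≡1 = x≈z//y p 1ℚ 1ℚ p+1≡1
complement p false p+0≡1 = trans (sym (ℚP.+-identityʳ p)) p+0≡1

data Literal : Set where
  pos neg : ℕ → Literal
  off     : Literal

⟦_⟧ : Literal → List Bool → Bool
⟦ pos k ⟧ α = bitAt α k
⟦ neg k ⟧ α = not (bitAt α k)
⟦ off   ⟧ α = false

LiteralMap : Set
LiteralMap = ℕ → Literal

Computes : LiteralMap → List Bool → List Bool → Set
Computes L α α′ = ∀ k → bitAt α′ k ≡ ⟦ L k ⟧ α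

record Encodes {t} (α : List Bool) (v : Fin (suc t) → ℚ) : Set where
  field
    mass : Σℚ v ≡ 1ℚ
    bits : ∀ j → v (suc j) ≡ 𝟙 (bitAt α (toℕ j))

unit : ∀ {t} → ℕ → Fin (suc t) → ℚ
unit k zero    = 0ℚ
unit k (suc j) = 𝟙 (toℕ j ≡ᵇ k)

coefficients : ∀ {t} → Literal → Fin (suc t) → ℚ
coefficients (pos k) c = unit k c
coefficients (neg k) c = 1ℚ ℚ.- unit k c
coefficients off     c = 0ℚ

literalMatrix : ∀ {t} → LiteralMap → Fin (suc t) → Fin (suc t) → ℚ
literalMatrix {t} L zero c = 1ℚ ℚ.- Σℚ {t} (λ i → coefficients (L (toℕ i)) c)
literalMatrix     L (suc i) c = coefficients (L (toℕ i)) c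

literalMatrix-columns : ∀ {t} (L : LiteralMap) c → Σℚ (λ r → literalMatrix {t} L r c) ≡ 1ℚ
literalMatrix-columns {t} L c =
  //-rightDividesˡ (Σℚ {t} (λ i → coefficients (L (toℕ i)) c)) 1ℚ

Σℚ-select-bit : ∀ {t} α k → length α ≡ t →
  Σℚ {t} (λ j → 𝟙 (toℕ j ≡ᵇ k) ℚ.* 𝟙 (bitAt α (toℕ j))) ≡ 𝟙 (bitAt α k)
Σℚ-select-bit []      k       refl = refl
Σℚ-select-bit (a ∷ α) zero    refl = begin
  1ℚ ℚ.* 𝟙 a ℚ.+ Σℚ {length α} (λ j → 0ℚ ℚ.* 𝟙 (bitAt α (toℕ j)))
    ≡⟨ cong₂ ℚ._+_ (ℚP.*-identityˡ (𝟙 a))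
               (Σℚ-cong {length α} (λ j → ℚP.*-zeroˡ (𝟙 (bitAt α (toℕ j))))) ⟩
  𝟙 a ℚ.+ Σℚ {length α} (λ _ → 0ℚ)
    ≡⟨ cong (𝟙 a ℚ.+_) (Σℚ-zero (length α)) ⟩
  𝟙 a ℚ.+ 0ℚ
    ≡⟨ ℚP.+-identityʳ (𝟙 a) ⟩
  𝟙 a ∎
Σℚ-select-bit (a ∷ α) (suc k) refl = begin
  0ℚ ℚ.* 𝟙 a ℚ.+ selected  ≡⟨ cong (ℚ._+ selected) (ℚP.*-zeroˡ (𝟙 a)) ⟩
  0ℚ ℚ.+ selected          ≡⟨ ℚP.+-identityˡ selected ⟩
  selected                 ≡⟨ Σℚ-select-bit α k refl ⟩
  𝟙 (bitAt α k)            ∎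
  where
  selected = Σℚ {length α} (λ j → 𝟙 (toℕ j ≡ᵇ k) ℚ.* 𝟙 (bitAt α (toℕ j)))

unit-sound : ∀ {t} k α (v : Fin (suc t) → ℚ) → length α ≡ t → Encodes α v →
  unit k · v ≡ 𝟙 (bitAt α k)
unit-sound {t} k α v len enc = begin
  0ℚ ℚ.* v zero ℚ.+ Σℚ (λ j → 𝟙 (toℕ j ≡ᵇ k) ℚ.* v (suc j))
    ≡⟨ cong₂ ℚ._+_ (ℚP.*-zeroˡ (v zero)) (Σℚ-cong (λ j → cong (𝟙 (toℕ j ≡ᵇ k) ℚ.*_) (bits j))) ⟩
  0ℚ ℚ.+ Σℚ {t} (λ j → 𝟙 (toℕ j ≡ᵇ k) ℚ.* 𝟙 (bitAt α (toℕ j)))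
    ≡⟨ ℚP.+-identityˡ _ ⟩
  Σℚ {t} (λ j → 𝟙 (toℕ j ≡ᵇ k) ℚ.* 𝟙 (bitAt α (toℕ j)))
    ≡⟨ Σℚ-select-bit α k len ⟩
  𝟙 (bitAt α k) ∎
  where open Encodes enc

coefficients-sound : ∀ {t} ℓ α (v : Fin (suc t) → ℚ) → length α ≡ t → Encodes α v →
  coefficients ℓ · v ≡ 𝟙 (⟦ ℓ ⟧ α)
coefficients-sound (pos k) α v len enc = unit-sound k α v len enc
coefficients-sound (neg k) α v len enc = complement _ (bitAt α k) (begin
  coefficients (neg k) · v ℚ.+ 𝟙 (bitAt α k)
    ≡⟨ cong (coefficients (neg k) · v ℚ.+_) (unit-sound k α v len enc) ⟨
  coefficients (neg k) · v ℚ.+ unit k · v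
    ≡⟨ Σℚ-distrib-+ (λ c → coefficients (neg k) c ℚ.* v c) (λ c → unit k c ℚ.* v c) ⟨
  Σℚ (λ c → (1ℚ ℚ.- unit k c) ℚ.* v c ℚ.+ unit k c ℚ.* v c)
    ≡⟨ Σℚ-cong (λ c → split (unit k c) (v c)) ⟩
  Σℚ v
    ≡⟨ Encodes.mass enc ⟩
  1ℚ ∎)
  where
  split : ∀ u p → (1ℚ ℚ.- u) ℚ.* p ℚ.+ u ℚ.* p ≡ p
  split u p = begin
    (1ℚ ℚ.- u) ℚ.* p ℚ.+ u ℚ.* p ≡⟨ ℚP.*-distribʳ-+ p (1ℚ ℚ.- u) u ⟨
    (1ℚ ℚ.- u ℚ.+ u) ℚ.* p       ≡⟨ cong (ℚ._* p) (//-rightDividesˡ u 1ℚ) ⟩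
    1ℚ ℚ.* p                     ≡⟨ ℚP.*-identityˡ p ⟩
    p                            ∎
coefficients-sound {t} off α v len enc =
  trans (Σℚ-cong (λ c → ℚP.*-zeroˡ (v c))) (Σℚ-zero (suc t))

literalMatrix-encodes : ∀ {t} L α α′ (v : Fin (suc t) → ℚ) → length α ≡ t → Encodes α v →
  Computes L α α′ → Encodes α′ (literalMatrix L ⊛ v)
literalMatrix-encodes L α α′ v len enc L-computes = record
  { mass = trans (⊛-preserves-mass (literalMatrix L) v (literalMatrix-columns L)) (Encodes.mass enc)
  ; bits = λ j → trans (coefficients-sound (L (toℕ j)) α v len enc)
                       (cong 𝟙 (sym (L-computes (toℕ j))))
  }

shiftIf : Bool → List Bool → Bool → List Bool
shiftIf true  l b = shiftX l b
shiftIf false l _ = l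

Registers : Set
Registers = List Bool × List Bool

readPair : Registers → Bool × Bool → Registers
readPair (α , β) (c , b) = shiftIf (not c) α b , shiftIf c β b

addressedBit : Registers → Bool
addressedBit (α , β) = bitAt α (bin β)

foldl-readPair : ∀ α β ps → foldl readPair (α , β) ps ≡
  (foldl shiftX α (dataBits false ps) , foldl shiftX β (dataBits true ps))
foldl-readPair α β []               = refl
foldl-readPair α β ((false , b) ∷ ps) = foldl-readPair (shiftX α b) β ps
foldl-readPair α β ((true  , b) ∷ ps) = foldl-readPair α (shiftX β b) ps

SSA≡addressedBit : ∀ d {n} (x : Fin n → Bool) →
  SSA d x ≡
  addressedBit (foldl readPair (replicate (2 ^ d) false , replicate d false) (pairs (toList x)))
SSA≡addressedBit d x = cong addressedBit (sym (foldl-readPair _ _ (pairs (toList x))))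

length-shiftX : ∀ l b → length (shiftX l b) ≡ length l
length-shiftX []      b = refl
length-shiftX (a ∷ l) b = trans (length-++ l) (+-comm (length l) 1)

length-shiftIf : ∀ s l b → length (shiftIf s l b) ≡ length l
length-shiftIf true  = length-shiftX
length-shiftIf false l b = refl

bitAt-snoc : ∀ l c k → bitAt (l ++ [ c ]) k ≡
  (if k <ᵇ length l then bitAt l k else if k ≡ᵇ length l then c else false)
bitAt-snoc []      c zero    = refl
bitAt-snoc []      c (suc k) = refl
bitAt-snoc (a ∷ l) c zero    = refl
bitAt-snoc (a ∷ l) c (suc k) = bitAt-snoc l c k

shiftMap : ℕ → Bool → LiteralMap
shiftMap w b k =
  if suc k <ᵇ w then pos (suc k) else if suc k ≡ᵇ w then (if b then neg 0 else pos 0) else off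

shiftX-computes : ∀ α b → Computes (shiftMap (length α) b) α (shiftX α b)
shiftX-computes []      b k = refl
shiftX-computes (a ∷ α) b k rewrite bitAt-snoc α (a xor b) k with k <ᵇ length α
... | true  = refl
... | false with k ≡ᵇ length α
...   | false = refl
...   | true  = xor-literal a b
  where
  xor-literal : ∀ a b → a xor b ≡ ⟦ if b then neg 0 else pos 0 ⟧ (a ∷ α)
  xor-literal false false = refl
  xor-literal false true  = refl
  xor-literal true  false = refl
  xor-literal true  true  = refl

shiftIfMap : ℕ → Bool → Bool → LiteralMap
shiftIfMap w true  b = shiftMap w b
shiftIfMap w false b = pos

shiftIf-computes : ∀ {w} s α b → length α ≡ w → Computes (shiftIfMap w s b) α (shiftIf s α b)
shiftIf-computes true  α b refl = shiftX-computes α b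
shiftIf-computes false α b refl k = refl

project : LiteralMap → ℕ → LiteralMap
project L a zero    = L a
project L a (suc _) = off

project-computes : ∀ {L α α′} a → Computes L α α′ → Computes (project L a) α [ bitAt α′ a ]
project-computes a L-computes zero    = L-computes a
project-computes a L-computes (suc k) = refl

encode : ∀ D → List Bool → Fin (2 ^ D)
encode zero    _       = zero
encode (suc D) []      = combine {2} zero (encode D [])
encode (suc D) (b ∷ l) = combine (Inverse.from 2↔Bool b) (encode D l)

decode : ∀ D → Fin (2 ^ D) → List Bool
decode zero    _ = []
decode (suc D) i = decodeHead (remQuot {2} (2 ^ D) i)
  where
  decodeHead : Fin 2 × Fin (2 ^ D) → List Bool
  decodeHead (b , j) = Inverse.to 2↔Bool b ∷ decode D j

decode-encode : ∀ {D} l → length l ≡ D → decode D (encode D l) ≡ l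
decode-encode []      refl = refl
decode-encode {suc D} (b ∷ l) refl =
  trans (cong (λ (b′ , j) → Inverse.to 2↔Bool b′ ∷ decode D j)
              (remQuot-combine (Inverse.from 2↔Bool b) (encode D l)))
        (cong₂ _∷_ (Inverse.strictlyInverseˡ 2↔Bool b) (decode-encode l refl))

data Phase : Set where
  controlBit dataBit lastDataBit : Phase

phase : ∀ {n} → Fin n → Phase
phase                     zero          = controlBit
phase {suc (suc zero)}    (suc zero)    = lastDataBit
phase {suc (suc (suc _))} (suc zero)    = dataBit
phase {suc (suc _)}       (suc (suc j)) = phase j

-- Structural doubling: Fin (suc (suc (twice (suc p)))) exposes two steps definitionally.
twice : ℕ → ℕ
twice zero    = zero
twice (suc p) = suc (suc (twice p))

module SSA-OBDD (d t : ℕ) where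

  transition : Phase → List Bool → Bool → List Bool × LiteralMap
  transition controlBit  (_ ∷ β) c = c ∷ β , pos
  transition dataBit     (c ∷ β) b = c ∷ shiftIf c β b , shiftIfMap (suc t) (not c) b
  transition lastDataBit (c ∷ β) b =
    c ∷ shiftIf c β b , project (shiftIfMap (suc t) (not c) b) (bin (shiftIf c β b))
  transition _           []      _ = [] , pos

  State : Set
  State = Fin (2 ^ suc d) × (Fin (suc (suc t)) → ℚ)

  applyTransition : List Bool × LiteralMap → (Fin (suc (suc t)) → ℚ) → State
  applyTransition (κ , L) v = encode (suc d) κ , literalMatrix L ⊛ v

  runStep : Phase → Bool → State → State
  runStep ph b (s , v) = applyTransition (transition ph (decode (suc d) s) b) v

  record Invariant (m : Registers) (c : Bool) (st : State) : Set where
    field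
      classical      : decode (suc d) (proj₁ st) ≡ c ∷ proj₂ m
      address-length : length (proj₂ m) ≡ d
      storage-length : length (proj₁ m) ≡ suc t
      encodes        : Encodes (proj₁ m) (proj₂ st)

  runStep-decoded : ∀ ph b {κ} (st : State) → decode (suc d) (proj₁ st) ≡ κ →
    runStep ph b st ≡ applyTransition (transition ph κ b) (proj₂ st)
  runStep-decoded ph b (s , v) decoded = cong (λ κ → applyTransition (transition ph κ b) v) decoded

  control-preserves : ∀ {α β c′} c st → Invariant (α , β) c′ st →
    Invariant (α , β) c (runStep controlBit c st)
  control-preserves {α} {β} c st I =
    subst (Invariant (α , β) c) (sym (runStep-decoded controlBit c st classical)) record
      { classical      = decode-encode (c ∷ β) (cong suc address-length)
      ; address-length = address-length
      ; storage-length = storage-length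
      ; encodes        = literalMatrix-encodes pos α α (proj₂ st)
                           storage-length encodes (λ _ → refl)
      }
    where open Invariant I

  data-preserves : ∀ {α β c} b st → Invariant (α , β) c st →
    Invariant (readPair (α , β) (c , b)) c (runStep dataBit b st)
  data-preserves {α} {β} {c} b st I =
    subst (Invariant (readPair (α , β) (c , b)) c)
          (sym (runStep-decoded dataBit b st classical)) record
      { classical      = decode-encode (c ∷ shiftIf c β b) (cong suc address-length′)
      ; address-length = address-length′
      ; storage-length = trans (length-shiftIf (not c) α b) storage-length
      ; encodes        = literalMatrix-encodes _ α (shiftIf (not c) α b) (proj₂ st)
                           storage-length encodes (shiftIf-computes (not c) α b storage-length)
      }
    where
    open Invariant I
    address-length′ = trans (length-shiftIf c β b) address-length

  lastData-encodes : ∀ {α β c} b st → Invariant (α , β) c st →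
    Encodes [ addressedBit (readPair (α , β) (c , b)) ] (proj₂ (runStep lastDataBit b st))
  lastData-encodes {α} {β} {c} b st I =
    subst (λ st′ → Encodes [ addressedBit (readPair (α , β) (c , b)) ] (proj₂ st′))
      (sym (runStep-decoded lastDataBit b st classical))
      (literalMatrix-encodes _ α [ addressedBit (readPair (α , β) (c , b)) ] (proj₂ st)
        storage-length encodes
        (project-computes {α′ = shiftIf (not c) α b} (bin (shiftIf c β b))
          (shiftIf-computes (not c) α b storage-length)))
    where open Invariant I

  initialVector : Fin (suc (suc t)) → ℚ
  initialVector zero    = 1ℚ
  initialVector (suc _) = 0ℚ

  initialVector-encodes : ∀ w → Encodes (replicate w false) initialVector
  initialVector-encodes w = record
    { mass = trans (cong (1ℚ ℚ.+_) (Σℚ-zero (suc t))) (ℚP.+-identityʳ 1ℚ)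
    ; bits = λ j → cong 𝟙 (sym (bitAt-replicate w (toℕ j)))
    }
    where
    bitAt-replicate : ∀ w k → bitAt (replicate w false) k ≡ false
    bitAt-replicate zero    k       = refl
    bitAt-replicate (suc w) zero    = refl
    bitAt-replicate (suc w) (suc k) = bitAt-replicate w k

  automaton : ∀ {n} → AfOBDD n (2 ^ suc d) (suc (suc t))
  automaton = record
    { δ         = λ j s b → encode (suc d) (proj₁ (transition (phase j) (decode (suc d) s) b))
    ; T         = λ j s b → literalMatrix (proj₂ (transition (phase j) (decode (suc d) s) b))
    ; sI        = encode (suc d) (false ∷ replicate d false)
    ; v₀        = initialVector
    ; Sa        = λ _ → true
    ; Ea        = λ i → toℕ i ≡ᵇ 1
    ; π         = id
    ; v₀-affine = Encodes.mass (initialVector-encodes 0)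
    ; T-affine  = λ j s b →
        literalMatrix-columns (proj₂ (transition (phase j) (decode (suc d) s) b))
    }

  module _ {n} (x : Fin n → Bool) where

    step-at-phase : ∀ (P : State → Set) j {ph} st → phase j ≡ ph →
      P (runStep ph (x j) st) → P (step automaton x j st)
    step-at-phase P j st phase≡ = subst (λ ph → P (runStep ph (x j) st)) (sym phase≡)

    control-step : ∀ {α β c} j st → phase j ≡ controlBit → Invariant (α , β) c st →
      Invariant (α , β) (x j) (step automaton x j st)
    control-step {α} {β} j st phase≡ I =
      step-at-phase (Invariant (α , β) (x j)) j st phase≡ (control-preserves (x j) st I)

    data-step : ∀ {α β c} j st → phase j ≡ dataBit → Invariant (α , β) c st →
      Invariant (readPair (α , β) (c , x j)) c (step automaton x j st)
    data-step {α} {β} {c} j st phase≡ I =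
      step-at-phase (Invariant (readPair (α , β) (c , x j)) c) j st phase≡
        (data-preserves (x j) st I)

    lastData-step : ∀ {α β c} j st → phase j ≡ lastDataBit → Invariant (α , β) c st →
      Encodes [ addressedBit (readPair (α , β) (c , x j)) ] (proj₂ (step automaton x j st))
    lastData-step {α} {β} {c} j st phase≡ I =
      step-at-phase (λ st′ → Encodes [ addressedBit (readPair (α , β) (c , x j)) ] (proj₂ st′))
        j st phase≡ (lastData-encodes (x j) st I)

    runFrom-encodes-addressedBit : ∀ p (idx : Fin (suc (suc (twice p))) → Fin n) →
      (∀ i → phase (idx i) ≡ phase i) → ∀ {m c} st → Invariant m c st →
      Encodes [ addressedBit (foldl readPair m (pairs (toList (x ∘ idx)))) ]
              (proj₂ (runFrom automaton x idx st))
    runFrom-encodes-addressedBit zero    idx phases {_ , _} st I =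
      lastData-step (idx 1F) _ (phases 1F) (control-step (idx 0F) st (phases 0F) I)
    runFrom-encodes-addressedBit (suc p) idx phases {_ , _} st I =
      runFrom-encodes-addressedBit p (λ i → idx (suc (suc i))) (λ i → phases (suc (suc i))) _
        (data-step (idx 1F) _ (phases 1F) (control-step (idx 0F) st (phases 0F) I))

  singletonEncoding : Bool → Fin (suc (suc t)) → ℚ
  singletonEncoding a zero          = 𝟙 (not a)
  singletonEncoding a (suc zero)    = 𝟙 a
  singletonEncoding a (suc (suc _)) = 0ℚ

  singleton-encoding-unique : ∀ {a} (v : Fin (suc (suc t)) → ℚ) → Encodes [ a ] v →
    ∀ i → v i ≡ singletonEncoding a i
  singleton-encoding-unique {a} v enc zero = complement (v zero) a (begin
    v zero ℚ.+ 𝟙 a               ≡⟨ cong (v zero ℚ.+_) (ℚP.+-identityʳ (𝟙 a)) ⟨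
    v zero ℚ.+ (𝟙 a ℚ.+ 0ℚ)       ≡⟨ cong₂ (λ p q → v zero ℚ.+ (p ℚ.+ q)) (bits zero) rest ⟨
    Σℚ v                         ≡⟨ mass ⟩
    1ℚ                           ∎)
    where
    open Encodes enc
    rest : Σℚ (λ j → v (suc (suc j))) ≡ 0ℚ
    rest = trans (Σℚ-cong (λ j → bits (suc j))) (Σℚ-zero t)
  singleton-encoding-unique v enc (suc zero)    = Encodes.bits enc zero
  singleton-encoding-unique v enc (suc (suc j)) = Encodes.bits enc (suc j)

  accProb-singleton : ∀ {n} (x : Fin n → Bool) a →
    Encodes [ a ] (proj₂ (final automaton x)) → accProb automaton x ≡ 𝟙 a
  accProb-singleton x a enc with final automaton x
  ... | (s , v) = begin
    safeDiv automaton x (Σℚ (λ i → if toℕ i ≡ᵇ 1 then ∣ v i ∣ else 0ℚ)) (Σℚ (λ i → ∣ v i ∣))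
      ≡⟨ cong₂ (safeDiv automaton x)
           (Σℚ-cong (λ i → cong (λ p → if toℕ i ≡ᵇ 1 then ∣ p ∣ else 0ℚ) (v≗singleton i)))
           (Σℚ-cong (λ i → cong ∣_∣ (v≗singleton i))) ⟩
    ratio a (Σℚ {t} (λ _ → 0ℚ)) ≡⟨ cong (ratio a) (Σℚ-zero t) ⟩
    ratio a 0ℚ                  ≡⟨ ratio-0 a ⟩
    𝟙 a                         ∎
    where
    v≗singleton = singleton-encoding-unique v enc
    ratio : Bool → ℚ → ℚ
    ratio a z = safeDiv automaton x (0ℚ ℚ.+ (∣ 𝟙 a ∣ ℚ.+ z)) (∣ 𝟙 (not a) ∣ ℚ.+ (∣ 𝟙 a ∣ ℚ.+ z))
    ratio-0 : ∀ a → ratio a 0ℚ ≡ 𝟙 a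
    ratio-0 false = refl
    ratio-0 true  = refl

  computes-SSA : ∀ p → 2 ^ d ≡ suc t → ComputesExactly (automaton {suc (suc (twice p))}) (SSA d)
  computes-SSA p 2^d≡1+t x = (λ SSA≡1 → trans accepts (cong 𝟙 SSA≡1)) , (λ SSA≡0 → trans accepts (cong 𝟙 SSA≡0))
    where
    initial : Invariant (replicate (2 ^ d) false , replicate d false) false
                        (encode (suc d) (false ∷ replicate d false) , initialVector)
    initial = record
      { classical      = decode-encode (false ∷ replicate d false) (cong suc (length-replicate d))
      ; address-length = length-replicate d
      ; storage-length = trans (length-replicate (2 ^ d)) 2^d≡1+t
      ; encodes        = initialVector-encodes (2 ^ d)
      }
    accepts : accProb automaton x ≡ 𝟙 (SSA d x)
    accepts = accProb-singleton x (SSA d x)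
      (subst (λ a → Encodes [ a ] (proj₂ (final automaton x))) (sym (SSA≡addressedBit d x))
        (runFrom-encodes-addressedBit x p (λ j → j) (λ _ → refl) _ initial))

2*≡twice : ∀ p → 2 * p ≡ twice p
2*≡twice zero    = refl
2*≡twice (suc p) = cong suc (trans (+-suc p (p + 0)) (cong suc (2*≡twice p)))

resize : ∀ {n n′ c c′ m m′} {f : ∀ {n} → (Fin n → Bool) → Bool} → n ≡ n′ → c ≡ c′ → m ≡ m′ →
  Σ (AfOBDD n c m) (λ A → ComputesExactly A f) → Σ (AfOBDD n′ c′ m′) (λ A → ComputesExactly A f)
resize refl refl refl A = A

-- The construction also works for d = 0.
theorem8 : (d n : ℕ) → 1 ≤ d → n ≡ 2 * (2 ^ d + d) →
    Σ (AfOBDD n (2 ^ (d + 1)) (2 ^ d + 1)) (λ A → ComputesExactly A (SSA d))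
theorem8 d n _ n≡2[2^d+d] =
  resize {f = SSA d} (sym n≡steps) (cong (2 ^_) (+-comm 1 d)) 2+t≡2^d+1
    (automaton , computes-SSA (t + d) 2^d≡1+t)
  where
  t = pred (2 ^ d)
  2^d≡1+t : 2 ^ d ≡ suc t
  2^d≡1+t = sym (suc-pred (2 ^ d) {{m^n≢0 2 d}})
  n≡steps : n ≡ suc (suc (twice (t + d)))
  n≡steps = trans n≡2[2^d+d] (trans (cong (λ k → 2 * (k + d)) 2^d≡1+t) (2*≡twice (suc (t + d))))
  2+t≡2^d+1 : suc (suc t) ≡ 2 ^ d + 1
  2+t≡2^d+1 = trans (+-comm 1 (suc t)) (cong (_+ 1) (sym 2^d≡1+t))
  open SSA-OBDD d t
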